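{- Let $P=([n],\le_P)$ be a poset and let $\Gamma$ be the matrix defined below. Then $\|\Gamma\|\ge \mathbb{E}_{\sigma\in\Delta(P)}\left[\sum_{i\in[n]}H_{d_i(\sigma)-1}\right]$, where $\sigma$ is uniform over $\Delta(P)$ and $\|\cdot\|$ is the spectral norm.
   Context: A linear extension of $P$ is a permutation $\sigma$ of $[n]$ ($\sigma(i)$ being the rank of $i$) with $i\le_P j\implies \sigma(i)\le\sigma(j)$; $\Delta(P)$ is the set of linear extensions. For a permutation $\sigma$ and integers $k\ge1,d\ge1$ with $k+d\le n$, $\sigma^{(k,d)}$ is the permutation obtained from $\sigma$ by moving the element in position $k+d$ down to position $k$: if $\tau=\sigma^{(k,d)}$ then $\sigma^{ -1}(k+d)=\tau^{ -1}(k)$, $\sigma^{ -1}(m)=\tau^{ -1}(m+1)$ for $k\le m<k+d$, and $\sigma^{ -1}(m)=\tau^{ -1}(m)$ otherwise. $\Gamma$ is the real symmetric matrix indexed by $\Delta(P)\times\Delta(P)$ with $\Gamma_{\sigma\tau}=\Gamma_{\tau\sigma}=1/d$ whenever $\tau=\sigma^{(k,d)}$ for some $k,d$, and all other entries $0$. For $y\in\mathbb{R}^n$ with $i\le_P j\implies y_i\le y_j$, define $d_i(y)=y_i$ if $i$ is a minimal element of $P$, and otherwise $d_i(y)=\min\{y_i-y_j : j\ne i,\ j\le_P i\}$. For $\sigma\in\Delta(P)$, $d_i(\sigma):=d_i((\sigma(1),\dots,\sigma(n)))$, a positive integer. $H_q=\sum_{m=1}^q 1/m$ is the $q$-th harmonic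 number, $H_0=0$. -}

module Defs where

open import Data.Bool using (Bool; true; false; _∧_; _∨_; not; if_then_else_)
open import Data.Nat as ℕ using (ℕ; zero; suc; _≡ᵇ_; _<ᵇ_; _≤ᵇ_)
open import Data.Fin using (Fin; toℕ)
open import Data.Vec using (Vec; []; _∷_; lookup) renaming (map to vmap)
open import Data.List using (List; []; _∷_; map; concatMap; upTo; allFin; filterᵇ; foldr; length)
open import Data.List.Base using () renaming (lookup to llookup)
open import Data.Bool.ListAction using (and)
open import Data.Integer using (+_)
open import Data.Rational using (ℚ; 0ℚ; _/_; _+_; _*_; _<_; _≤_)
open import Data.Product using (∃)
open import Relation.Binary.PropositionalEquality using (_≡_)

record IsPoset {n : ℕ} (le : Fin n → Fin n → Bool) : Set where
  field
    refl  : ∀ i → le i i ≡ true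
    antisym : ∀ i j → le i j ≡ true → le j i ≡ true → i ≡ j
    trans : ∀ i j k → le i j ≡ true → le j k ≡ true → le i k ≡ true

-- permutations are represented by their rank vectors: σ = (σ(1),…,σ(n)), ranks in {1,…,n}
Rank : ℕ → Set
Rank n = Vec ℕ n

ranks : ℕ → List ℕ
ranks n = map suc (upTo n)

allVecs : ℕ → (k : ℕ) → List (Vec ℕ k)
allVecs n zero = [] ∷ []
allVecs n (suc k) = concatMap (λ r → map (r ∷_) (allVecs n k)) (ranks n)

finEq : ∀ {n} → Fin n → Fin n → Bool
finEq i j = toℕ i ≡ᵇ toℕ j

vecEq : ∀ {k} → Vec ℕ k → Vec ℕ k → Bool
vecEq [] [] = true
vecEq (a ∷ as) (b ∷ bs) = (a ≡ᵇ b) ∧ vecEq as bs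

-- σ is a permutation of [n] (injective, entries in [n]) which is a linear extension of le
isLinExt : ∀ {n} → (Fin n → Fin n → Bool) → Vec ℕ n → Bool
isLinExt {n} le σ =
  and (map (λ i → and (map (λ j →
        (finEq i j ∨ not (lookup σ i ≡ᵇ lookup σ j))
        ∧ (not (le i j) ∨ (lookup σ i ≤ᵇ lookup σ j))) (allFin n))) (allFin n))

Δ : ∀ {n} → (Fin n → Fin n → Bool) → List (Vec ℕ n)
Δ {n} le = filterᵇ (isLinExt le) (allVecs n n)

-- σ^(k,d) on rank vectors: the element with rank k+d gets rank k,
-- elements with rank in [k, k+d) move up by one, others unchanged
shiftRank : ℕ → ℕ → ℕ → ℕ
shiftRank k d r =
  if r ≡ᵇ (k ℕ.+ d) then k
  else (if (k ≤ᵇ r) ∧ (r <ᵇ (k ℕ.+ d)) then suc r else r)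

shift : ∀ {n} → ℕ → ℕ → Vec ℕ n → Vec ℕ n
shift k d σ = vmap (shiftRank k d) σ

isShift : ∀ {n} → Vec ℕ n → Vec ℕ n → ℕ → ℕ → Bool
isShift σ τ k d' = vecEq τ (shift k (suc d') σ)

-- Γ entry for the pair (σ, τ): 1/d if τ = σ^(k,d) or σ = τ^(k,d) for some k ≥ 1, d ≥ 1, k + d ≤ n
-- (such (k,d) is unique when it exists); 0 otherwise.
gammaEntry : ∀ {n} → Vec ℕ n → Vec ℕ n → ℚ
gammaEntry {n} σ τ =
  foldr (λ k acc → foldr (λ d' acc' →
      if ((k ℕ.+ suc d') ≤ᵇ n) ∧ (isShift σ τ k d' ∨ isShift τ σ k d')
      then (+ 1) / suc d' else acc') acc (upTo n)) 0ℚ (ranks n)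

-- Γ as a matrix indexed by positions in the list Δ(P)
N : ∀ {n} → (Fin n → Fin n → Bool) → ℕ
N le = length (Δ le)

Γ : ∀ {n} (le : Fin n → Fin n → Bool) → Fin (N le) → Fin (N le) → ℚ
Γ le a b = gammaEntry (llookup (Δ le) a) (llookup (Δ le) b)

dist : ∀ {n} → (Fin n → Fin n → Bool) → Vec ℕ n → Fin n → ℕ
dist {n} le σ i with filterᵇ (λ j → not (finEq j i) ∧ le j i) (allFin n)
... | [] = lookup σ i
... | j ∷ js = foldr (λ j' m → m ℕ.⊓ (lookup σ i ℕ.∸ lookup σ j')) (lookup σ i ℕ.∸ lookup σ j) js

H : ℕ → ℚ
H zero = 0ℚ
H (suc q) = H q + (+ 1) / suc q

sumℚ : List ℚ → ℚ
sumℚ = foldr _+_ 0ℚ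

harmSum : ∀ {n} → (Fin n → Fin n → Bool) → Vec ℕ n → ℚ
harmSum {n} le σ = sumℚ (map (λ i → H (dist le σ i ℕ.∸ 1)) (allFin n))

-- uniform average over a list (0 for the empty list, which never occurs for Δ(P))
average : List ℚ → ℚ
average [] = 0ℚ
average (x ∷ xs) = sumℚ (x ∷ xs) * ((+ 1) / length (x ∷ xs))

expectation : ∀ {n} → (Fin n → Fin n → Bool) → ℚ
expectation le = average (map (harmSum le) (Δ le))

sumF : ∀ {m} → (Fin m → ℚ) → ℚ
sumF {m} f = sumℚ (map f (allFin m))

mulVec : ∀ {m} → (Fin m → Fin m → ℚ) → (Fin m → ℚ) → Fin m → ℚ
mulVec M x a = sumF (λ b → M a b * x b)

normSq : ∀ {m} → (Fin m → ℚ) → ℚ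
normSq x = sumF (λ a → x a * x a)

-- ‖M‖ ≥ c for the spectral (operator 2-)norm ‖M‖ = sup_{x ≠ 0} ‖Mx‖/‖x‖:
-- every nonnegative q < c is strictly exceeded by some ratio ‖Mx‖/‖x‖,
-- i.e. q² ‖x‖² < ‖Mx‖² (this forces x ≠ 0).
SpecNormAtLeast : ∀ {m} → (Fin m → Fin m → ℚ) → ℚ → Set
SpecNormAtLeast {m} M c =
  ∀ q → 0ℚ ≤ q → q < c → ∃ λ (x : Fin m → ℚ) → (q * q) * normSq x < normSq (mulVec M x)

{-# OPTIONS --safe #-}
module Submission where

-- Test Γ on the all-ones vector 1, so that (Γ1)_σ is the row sum of Γ at σ. If 1 ≤ d < d_i(σ),
-- every element strictly below i has rank less than σ(i) − d, so moving i down d places,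
-- σ^(σ(i)−d, d), is again a linear extension, and Γ gives it weight exactly 1/d. These
-- neighbours are pairwise distinct and Γ ≥ 0, hence the row sum at σ is at least
-- Σ_i Σ_{d < d_i(σ)} 1/d = Σ_i H_{d_i(σ)−1} =: h(σ). Finally ‖Γ1‖² ≥ Σ_σ h(σ)² ≥ |Δ(P)| E²
-- with E the mean of h, while ‖1‖² = |Δ(P)|.

open import Defs
open import Data.Bool using (Bool; true; false; T; T?; not; _∧_; _∨_; if_then_else_)
open import Data.Bool.Properties using (T-∧; T-∨; ∨-comm)
open import Data.Bool.ListAction using (all)
open import Data.Nat using (ℕ; zero; suc)
open import Data.Fin using (Fin; toℕ; fromℕ<; punchOut)
import Data.Fin as Fin
open import Data.Fin.Properties using (toℕ-injective; toℕ-fromℕ<; punchOut-injective; injective⇒≤; any?)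
open import Data.Vec using (Vec; []; _∷_; lookup)
open import Data.Vec.Properties using (lookup-map)
open import Data.List
  using (List; []; _∷_; map; _++_; foldr; concatMap; upTo; downFrom; allFin; filterᵇ; tabulate; length)
open import Data.List.Base using () renaming (lookup to llookup)
open import Data.List.Properties using (map-∘; length-map; map-tabulate; tabulate-lookup; map-cong)
open import Data.List.Membership.Propositional using (_∈_; find; lose)
open import Data.List.Membership.Propositional.Properties
  using ( ∈-map⁺; ∈-map⁻; ∈-concatMap⁺; ∈-concatMap⁻; ∈-upTo⁺; ∈-upTo⁻; ∈-downFrom⁻
        ; ∈-allFin; ∈-filter⁺; ∈-filter⁻; ∈-∃++; ∈-++⁺ˡ; ∈-++⁺ʳ; ∈-++⁻)
open import Data.List.Relation.Unary.Any using (Any; here; there)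
import Data.List.Relation.Unary.All as All
import Data.List.Relation.Unary.All.Properties as All
import Data.List.Relation.Unary.AllPairs as AllPairs
import Data.List.Relation.Unary.AllPairs.Properties as AllPairs
open import Data.List.Relation.Unary.Unique.Propositional using (Unique; _∷_)
import Data.List.Relation.Unary.Unique.Propositional.Properties as Unique
open import Data.List.Relation.Binary.Disjoint.Propositional using (Disjoint)
open import Data.Integer using (+_)
open import Data.Product using (_×_; _,_; proj₁; proj₂; ∃)
open import Data.Sum using (_⊎_; inj₁; inj₂)
open import Function using (_∘_; id; Injective; Equivalence; _⇔_; mk⇔)
open import Relation.Nullary using (yes; no; contradiction)
open import Relation.Nullary.Reflects using (Reflects; ofʸ; ofⁿ; fromEquivalence)
open import Relation.Binary.PropositionalEquality
  using (_≡_; _≢_; refl; sym; trans; cong; cong₂; subst; subst₂; module ≡-Reasoning)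

module Sums where

  open import Data.Rational using (ℚ; 0ℚ; _+_; _*_; _≤_)
  open import Data.Rational.Properties
    using ( ≤-refl; +-mono-≤; +-monoʳ-≤; +-assoc; +-identityˡ; *-zeroʳ; *-distribˡ-+
          ; +-0-commutativeMonoid; module ≤-Reasoning)
  open import Algebra.Bundles using (CommutativeMonoid)
  open import Algebra.Properties.CommutativeSemigroup
    (CommutativeMonoid.commutativeSemigroup +-0-commutativeMonoid) using (x∙yz≈y∙xz; interchange)

  private
    variable
      A B : Set

  ∑ : (A → ℚ) → List A → ℚ
  ∑ f xs = sumℚ (map f xs)

  infix 8 ∑
  syntax ∑ (λ x → e) xs = ∑[ x ∈ xs ] e

  ∑-cong : {f g : A → ℚ} (xs : List A) → (∀ {x} → x ∈ xs → f x ≡ g x) → ∑ f xs ≡ ∑ g xs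
  ∑-cong []       f≡g = refl
  ∑-cong (x ∷ xs) f≡g = cong₂ _+_ (f≡g (here refl)) (∑-cong xs (f≡g ∘ there))

  ∑-mono-≤ : {f g : A → ℚ} (xs : List A) → (∀ {x} → x ∈ xs → f x ≤ g x) → ∑ f xs ≤ ∑ g xs
  ∑-mono-≤ []       f≤g = ≤-refl
  ∑-mono-≤ (x ∷ xs) f≤g = +-mono-≤ (f≤g (here refl)) (∑-mono-≤ xs (f≤g ∘ there))

  ∑-nonNeg : {f : A → ℚ} (xs : List A) → (∀ {x} → x ∈ xs → 0ℚ ≤ f x) → 0ℚ ≤ ∑ f xs
  ∑-nonNeg []       f≥0 = ≤-refl
  ∑-nonNeg (x ∷ xs) f≥0 = +-mono-≤ (f≥0 (here refl)) (∑-nonNeg xs (f≥0 ∘ there))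

  ∑-++ : (f : A → ℚ) (xs ys : List A) → ∑ f (xs ++ ys) ≡ ∑ f xs + ∑ f ys
  ∑-++ f []       ys = sym (+-identityˡ (∑ f ys))
  ∑-++ f (x ∷ xs) ys = trans (cong (_+_ (f x)) (∑-++ f xs ys)) (sym (+-assoc (f x) (∑ f xs) (∑ f ys)))

  ∑-+ : (f g : A → ℚ) (xs : List A) → ∑[ x ∈ xs ] (f x + g x) ≡ ∑ f xs + ∑ g xs
  ∑-+ f g []       = refl
  ∑-+ f g (x ∷ xs) = trans (cong (_+_ (f x + g x)) (∑-+ f g xs)) (interchange (f x) (g x) (∑ f xs) (∑ g xs))

  ∑-*ˡ : (c : ℚ) (f : A → ℚ) (xs : List A) → ∑[ x ∈ xs ] (c * f x) ≡ c * ∑ f xs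
  ∑-*ˡ c f []       = sym (*-zeroʳ c)
  ∑-*ˡ c f (x ∷ xs) = trans (cong (_+_ (c * f x)) (∑-*ˡ c f xs)) (sym (*-distribˡ-+ c (f x) (∑ f xs)))

  ∑-map : (f : B → ℚ) (g : A → B) (xs : List A) → ∑ f (map g xs) ≡ ∑ (f ∘ g) xs
  ∑-map f g xs = cong sumℚ (sym (map-∘ xs))

  ∑-concatMap : (f : B → ℚ) (g : A → List B) (xs : List A) → ∑ f (concatMap g xs) ≡ ∑[ x ∈ xs ] ∑ f (g x)
  ∑-concatMap f g []       = refl
  ∑-concatMap f g (x ∷ xs) = trans (∑-++ f (g x) (concatMap g xs)) (cong (_+_ (∑ f (g x))) (∑-concatMap f g xs))

  ∑-insert : (f : A → ℚ) (xs ys : List A) (z : A) → ∑ f (xs ++ z ∷ ys) ≡ f z + ∑ f (xs ++ ys)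
  ∑-insert f xs ys z = begin
    ∑ f (xs ++ z ∷ ys)         ≡⟨ ∑-++ f xs (z ∷ ys) ⟩
    ∑ f xs + (f z + ∑ f ys)    ≡⟨ x∙yz≈y∙xz (∑ f xs) (f z) (∑ f ys) ⟩
    f z + (∑ f xs + ∑ f ys)    ≡⟨ cong (_+_ (f z)) (∑-++ f xs ys) ⟨
    f z + ∑ f (xs ++ ys)       ∎
    where open ≡-Reasoning

  ∑-≤-injective : {F : B → A} {g : A → ℚ} {ys : List B} {xs : List A} →
                  Unique ys → (∀ {y y′} → y ∈ ys → y′ ∈ ys → F y ≡ F y′ → y ≡ y′) →
                  (∀ {y} → y ∈ ys → F y ∈ xs) → (∀ {x} → x ∈ xs → 0ℚ ≤ g x) →
                  ∑ (g ∘ F) ys ≤ ∑ g xs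
  ∑-≤-injective {ys = []} {xs} _ _ _ g≥0 = ∑-nonNeg xs g≥0
  ∑-≤-injective {F = F} {g} {ys = y ∷ ys} (y∉ys ∷ unique) F-inj F∈xs g≥0
    with xs₁ , xs₂ , refl ← ∈-∃++ (F∈xs (here refl)) = begin
      g (F y) + ∑ (g ∘ F) ys
        ≤⟨ +-monoʳ-≤ (g (F y)) (∑-≤-injective unique F-inj′ F∈xs′ g≥0′) ⟩
      g (F y) + ∑ g (xs₁ ++ xs₂)
        ≡⟨ ∑-insert g xs₁ xs₂ (F y) ⟨
      ∑ g (xs₁ ++ F y ∷ xs₂)
        ∎
    where
    open ≤-Reasoning
    F-inj′ : ∀ {y y′} → y ∈ ys → y′ ∈ ys → F y ≡ F y′ → y ≡ y′
    F-inj′ y∈ y′∈ = F-inj (there y∈) (there y′∈)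
    F∈xs′ : ∀ {y′} → y′ ∈ ys → F y′ ∈ xs₁ ++ xs₂
    F∈xs′ {y′} y′∈ys with ∈-++⁻ xs₁ (F∈xs (there y′∈ys))
    ... | inj₁ ∈xs₁          = ∈-++⁺ˡ ∈xs₁
    ... | inj₂ (there ∈xs₂)  = ∈-++⁺ʳ xs₁ ∈xs₂
    ... | inj₂ (here Fy′≡Fy) =
      contradiction (F-inj (here refl) (there y′∈ys) (sym Fy′≡Fy)) (All.lookup y∉ys y′∈ys)
    g≥0′ : ∀ {x} → x ∈ xs₁ ++ xs₂ → 0ℚ ≤ g x
    g≥0′ x∈ with ∈-++⁻ xs₁ x∈
    ... | inj₁ ∈xs₁ = g≥0 (∈-++⁺ˡ ∈xs₁)
    ... | inj₂ ∈xs₂ = g≥0 (∈-++⁺ʳ xs₁ (there ∈xs₂))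

open Sums

module BooleanTests where

  open import Data.Nat using (_≡ᵇ_)
  open import Data.Nat.Properties using (≡ᵇ⇒≡; ≡⇒≡ᵇ)

  T-not-∨ : ∀ {a b} → T (not a ∨ b) ⇔ (T a → T b)
  T-not-∨ {false} = mk⇔ (λ _ ()) (λ _ → _)
  T-not-∨ {true}  = mk⇔ (λ b _ → b) (λ a→b → a→b _)

  ≡ᵇ-reflects-≡ : ∀ m n → Reflects (m ≡ n) (m ≡ᵇ n)
  ≡ᵇ-reflects-≡ m n = fromEquivalence (≡ᵇ⇒≡ m n) (≡⇒≡ᵇ m n)

  finEq-reflects : ∀ {n} (i j : Fin n) → Reflects (i ≡ j) (finEq i j)
  finEq-reflects i j = fromEquivalence (toℕ-injective ∘ ≡ᵇ⇒≡ _ _) (≡⇒≡ᵇ _ _ ∘ cong toℕ)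

  T-not-finEq : ∀ {n} {i j : Fin n} → i ≢ j → T (not (finEq i j))
  T-not-finEq {i = i} {j} i≢j with finEq i j | finEq-reflects i j
  ... | true  | ofʸ i≡j = i≢j i≡j
  ... | false | _       = _

  vecEq⇒≡ : ∀ {k} {u v : Vec ℕ k} → T (vecEq u v) → u ≡ v
  vecEq⇒≡ {u = []}    {[]}    _ = refl
  vecEq⇒≡ {u = a ∷ u} {b ∷ v} t with a≡b , u≡v ← Equivalence.to (T-∧ {a ≡ᵇ b}) t =
    cong₂ _∷_ (≡ᵇ⇒≡ a b a≡b) (vecEq⇒≡ u≡v)

  vecEq-refl : ∀ {k} (v : Vec ℕ k) → T (vecEq v v)
  vecEq-refl []      = _
  vecEq-refl (a ∷ v) = Equivalence.from T-∧ (≡⇒≡ᵇ a a refl , vecEq-refl v)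

open BooleanTests

-- gammaEntry σ τ is such a search over (k, d′) ∈ ranks n × upTo n, returning 1/(d′ + 1) at the first hit.
module FirstHit {A B C : Set} (hit : A → B → Bool) (val : B → C) (P : C → Set) where

  private
    scan : A → C → List B → C
    scan k z ds = foldr (λ d acc → if hit k d then val d else acc) z ds

    module _ {k : A} where

      scan-preserves : ∀ {z} ds → P z →
                       (∀ {d} → d ∈ ds → T (hit k d) → P (val d)) → P (scan k z ds)
      scan-preserves []       Pz _  = Pz
      scan-preserves (d ∷ ds) Pz ok with hit k d | ok (here refl)
      ... | true  | ok-d = ok-d _
      ... | false | _    = scan-preserves ds Pz (ok ∘ there)

      scan-hit : ∀ {z ds} → Any (T ∘ hit k) ds →
                 (∀ {d} → d ∈ ds → T (hit k d) → P (val d)) → P (scan k z ds)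
      scan-hit {ds = d ∷ _} (here h) ok with hit k d | h | ok (here refl)
      ... | true  | _ | ok-d = ok-d _
      scan-hit {ds = d ∷ _} (there hs) ok with hit k d | ok (here refl)
      ... | true  | ok-d = ok-d _
      ... | false | _    = scan-hit hs (ok ∘ there)

  search-satisfies : ∀ {z} ks ds → P z ⊎ Any (λ k → Any (T ∘ hit k) ds) ks →
                     (∀ {k d} → k ∈ ks → d ∈ ds → T (hit k d) → P (val d)) →
                     P (foldr (λ k acc → scan k acc ds) z ks)
  search-satisfies []       ds (inj₁ Pz)        ok = Pz
  search-satisfies (k ∷ ks) ds (inj₁ Pz)        ok =
    scan-preserves ds (search-satisfies ks ds (inj₁ Pz) (ok ∘ there)) (ok (here refl))
  search-satisfies (k ∷ ks) ds (inj₂ (here h))  ok = scan-hit h (ok (here refl))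
  search-satisfies (k ∷ ks) ds (inj₂ (there h)) ok =
    scan-preserves ds (search-satisfies ks ds (inj₂ h) (ok ∘ there)) (ok (here refl))

module ShiftRank where

  open import Data.Nat using (_+_; _≤_; _<_; s≤s; z≤n; _≡ᵇ_; _≤ᵇ_; _<ᵇ_)
  open import Data.Nat.Properties
    using ( ≤ᵇ-reflects-≤; <ᵇ-reflects-<; ≤-refl; ≤-reflexive; ≤-trans; <-irrefl; suc-injective
          ; ≤∧≢⇒<; ≮⇒≥; ≰⇒>; <⇒≢; <⇒≱; <⇒≯; ≤⇒≯; m≤m+n; n≤1+n; n<1+n)

  data ShiftRankView (k d r : ℕ) : ℕ → Set where
    top     : r ≡ k + d → ShiftRankView k d r k
    inside  : k ≤ r → r < k + d → ShiftRankView k d r (suc r)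
    outside : r ≢ k + d → r < k ⊎ k + d < r → ShiftRankView k d r r

  shiftRank-view : ∀ k d r → ShiftRankView k d r (shiftRank k d r)
  shiftRank-view k d r
    with r ≡ᵇ k + d | ≡ᵇ-reflects-≡ r (k + d)
  ... | true  | ofʸ r≡k+d = top r≡k+d
  ... | false | ofⁿ r≢k+d
    with k ≤ᵇ r | ≤ᵇ-reflects-≤ k r | r <ᵇ k + d | <ᵇ-reflects-< r (k + d)
  ... | true  | ofʸ k≤r | true  | ofʸ r<k+d = inside k≤r r<k+d
  ... | true  | ofʸ k≤r | false | ofⁿ r≮k+d =
    outside r≢k+d (inj₂ (≤∧≢⇒< (≮⇒≥ r≮k+d) (r≢k+d ∘ sym)))
  ... | false | ofⁿ k≰r | _     | _         = outside r≢k+d (inj₁ (≰⇒> k≰r))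

  module _ {k d : ℕ} where

    shiftRank-top : shiftRank k d (k + d) ≡ k
    shiftRank-top with shiftRank k d (k + d) | shiftRank-view k d (k + d)
    ... | _ | top _             = refl
    ... | _ | inside _ k+d<k+d  = contradiction k+d<k+d (<-irrefl refl)
    ... | _ | outside k+d≢k+d _ = contradiction refl k+d≢k+d

    shiftRank-inside : ∀ {r} → k ≤ r → r < k + d → shiftRank k d r ≡ suc r
    shiftRank-inside {r} k≤r r<k+d with shiftRank k d r | shiftRank-view k d r
    ... | _ | top r≡k+d              = contradiction r≡k+d (<⇒≢ r<k+d)
    ... | _ | inside _ _             = refl
    ... | _ | outside _ (inj₁ r<k)   = contradiction k≤r (<⇒≱ r<k)
    ... | _ | outside _ (inj₂ k+d<r) = contradiction r<k+d (<⇒≯ k+d<r)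

    shiftRank-below : ∀ {r} → r < k → shiftRank k d r ≡ r
    shiftRank-below {r} r<k with shiftRank k d r | shiftRank-view k d r
    ... | _ | top r≡k+d    = contradiction (subst (_< k) r≡k+d r<k) (≤⇒≯ (m≤m+n k d))
    ... | _ | inside k≤r _ = contradiction k≤r (<⇒≱ r<k)
    ... | _ | outside _ _  = refl

    shiftRank-decreasing : ∀ {r} → shiftRank k d r < r → r ≡ k + d × shiftRank k d r ≡ k
    shiftRank-decreasing {r} lt with shiftRank k d r | shiftRank-view k d r
    ... | _ | top r≡k+d   = r≡k+d , refl
    ... | _ | inside _ _  = contradiction lt (<⇒≯ (n<1+n r))
    ... | _ | outside _ _ = contradiction lt (<-irrefl refl)

    shiftRank-increasing : ∀ {r} → r < shiftRank k d r → shiftRank k d r ≡ suc r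
    shiftRank-increasing {r} gt with shiftRank k d r | shiftRank-view k d r
    ... | _ | top r≡k+d   = contradiction (subst (_< k) r≡k+d gt) (≤⇒≯ (m≤m+n k d))
    ... | _ | inside _ _  = refl
    ... | _ | outside _ _ = contradiction gt (<-irrefl refl)

    shiftRank-≤-suc : ∀ r → shiftRank k d r ≤ suc r
    shiftRank-≤-suc r with shiftRank k d r | shiftRank-view k d r
    ... | _ | top r≡k+d   = ≤-trans (m≤m+n k d) (≤-trans (≤-reflexive (sym r≡k+d)) (n≤1+n r))
    ... | _ | inside _ _  = ≤-refl
    ... | _ | outside _ _ = n≤1+n r

    shiftRank-≥ : ∀ {r} → r ≢ k + d → r ≤ shiftRank k d r
    shiftRank-≥ {r} r≢k+d with shiftRank k d r | shiftRank-view k d r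
    ... | _ | top r≡k+d   = contradiction r≡k+d r≢k+d
    ... | _ | inside _ _  = n≤1+n r
    ... | _ | outside _ _ = ≤-refl

    shiftRank-mono : ∀ {r s} → r < s → s ≢ k + d → shiftRank k d r ≤ shiftRank k d s
    shiftRank-mono {r} r<s s≢k+d = ≤-trans (shiftRank-≤-suc r) (≤-trans r<s (shiftRank-≥ s≢k+d))

    private
      outside-≢ : ∀ {t} → t < k ⊎ k + d < t → t ≢ k
      outside-≢ (inj₁ t<k)   t≡k  = <-irrefl t≡k t<k
      outside-≢ (inj₂ k+d<t) refl = <⇒≱ k+d<t (m≤m+n k d)

      inside-outside : ∀ {t u} → k ≤ t → t < k + d → u < k ⊎ k + d < u → suc t ≢ u
      inside-outside k≤t _   (inj₁ u<k)   refl = <⇒≱ u<k (≤-trans k≤t (n≤1+n _))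
      inside-outside _   t<  (inj₂ k+d<u) refl = <⇒≱ k+d<u t<

    shiftRank-injective : ∀ {r s} → shiftRank k d r ≡ shiftRank k d s → r ≡ s
    shiftRank-injective {r} {s} eq
      with shiftRank k d r | shiftRank-view k d r | shiftRank k d s | shiftRank-view k d s
    ... | _ | top r≡        | _ | top s≡        = trans r≡ (sym s≡)
    ... | _ | top _         | _ | inside k≤s _  = contradiction (subst (_≤ s) eq k≤s) (<-irrefl refl)
    ... | _ | top _         | _ | outside _ out = contradiction eq (outside-≢ out ∘ sym)
    ... | _ | inside k≤r _  | _ | top _         = contradiction (subst (_≤ r) (sym eq) k≤r) (<-irrefl refl)
    ... | _ | inside _ _    | _ | inside _ _    = suc-injective eq
    ... | _ | inside k≤r r< | _ | outside _ out = contradiction eq (inside-outside k≤r r< out)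
    ... | _ | outside _ out | _ | top _         = contradiction eq (outside-≢ out)
    ... | _ | outside _ out | _ | inside k≤s s< = contradiction (sym eq) (inside-outside k≤s s< out)
    ... | _ | outside _ _   | _ | outside _ _   = eq

    shiftRank-range : ∀ {n r} → 0 < k → k + d ≤ n → 0 < r → r ≤ n →
                      0 < shiftRank k d r × shiftRank k d r ≤ n
    shiftRank-range {n} {r} k>0 k+d≤n r>0 r≤n with shiftRank k d r | shiftRank-view k d r
    ... | _ | top _          = k>0 , ≤-trans (m≤m+n k d) k+d≤n
    ... | _ | inside _ r<k+d = s≤s z≤n , ≤-trans r<k+d k+d≤n
    ... | _ | outside _ _    = r>0 , r≤n

open ShiftRank

module LinearExtensions where

  open import Data.Nat using (_≤_; _<_; s≤s; z≤n; _≡ᵇ_; _≤ᵇ_)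
  open import Data.Nat.Properties using (≡ᵇ⇒≡; ≡⇒≡ᵇ; ≤ᵇ⇒≤; ≤⇒≤ᵇ; _≟_; <-irrefl; ≤-trans)

  ∈-ranks⁻ : ∀ {n r} → r ∈ ranks n → 0 < r × r ≤ n
  ∈-ranks⁻ r∈ with _ , x∈ , refl ← ∈-map⁻ suc r∈ = s≤s z≤n , ∈-upTo⁻ x∈

  ∈-ranks⁺ : ∀ {n r} → 0 < r → r ≤ n → r ∈ ranks n
  ∈-ranks⁺ {r = suc r} _ r<n = ∈-map⁺ suc (∈-upTo⁺ r<n)

  ∈-allVecs⁻ : ∀ {n k} {v : Vec ℕ k} → v ∈ allVecs n k → ∀ i → lookup v i ∈ ranks n
  ∈-allVecs⁻ {n} {suc k} v∈
    with r , r∈ , rw∈ ← find (∈-concatMap⁻ (λ r → map (r ∷_) (allVecs n k)) {xs = ranks n} v∈)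
    with w , w∈ , refl ← ∈-map⁻ (r ∷_) rw∈
    = λ { Fin.zero → r∈ ; (Fin.suc i) → ∈-allVecs⁻ w∈ i }

  ∈-allVecs⁺ : ∀ {n k} (v : Vec ℕ k) → (∀ i → lookup v i ∈ ranks n) → v ∈ allVecs n k
  ∈-allVecs⁺           []      _       = here refl
  ∈-allVecs⁺ {n} {suc k} (x ∷ v) v∈ranks =
    ∈-concatMap⁺ (λ r → map (r ∷_) (allVecs n k)) {xs = ranks n}
      (lose (v∈ranks Fin.zero) (∈-map⁺ (x ∷_) (∈-allVecs⁺ v (v∈ranks ∘ Fin.suc))))

  record IsLinearExtension {n} (le : Fin n → Fin n → Bool) (σ : Vec ℕ n) : Set where
    field
      rank-pos  : ∀ i → 0 < lookup σ i
      rank-≤    : ∀ i → lookup σ i ≤ n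
      injective : Injective _≡_ _≡_ (lookup σ)
      monotone  : ∀ {i j} → T (le i j) → lookup σ i ≤ lookup σ j

  module _ {n} {le : Fin n → Fin n → Bool} {σ : Vec ℕ n} where

    private
      entry : Fin n → Fin n → Bool
      entry i j = (finEq i j ∨ not (lookup σ i ≡ᵇ lookup σ j))
                ∧ (not (le i j) ∨ (lookup σ i ≤ᵇ lookup σ j))

      T-entry-injective : ∀ i j → T (not (lookup σ i ≡ᵇ lookup σ j) ∨ finEq i j) ⇔
                                  (lookup σ i ≡ lookup σ j → i ≡ j)
      T-entry-injective i j = mk⇔
        (λ t eq → toℕ-injective (≡ᵇ⇒≡ _ _ (Equivalence.to T-not-∨ t (≡⇒≡ᵇ _ _ eq))))
        (λ inj → Equivalence.from T-not-∨ (λ t → ≡⇒≡ᵇ _ _ (cong toℕ (inj (≡ᵇ⇒≡ _ _ t)))))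

      entry⁻ : ∀ {i j} → T (entry i j) →
               (lookup σ i ≡ lookup σ j → i ≡ j) × (T (le i j) → lookup σ i ≤ lookup σ j)
      entry⁻ {i} {j} t with inj , mono ← Equivalence.to (T-∧ {finEq i j ∨ _}) t =
        Equivalence.to (T-entry-injective i j) (subst T (∨-comm (finEq i j) _) inj) ,
        ≤ᵇ⇒≤ _ _ ∘ Equivalence.to T-not-∨ mono

      entry⁺ : ∀ {i j} → (lookup σ i ≡ lookup σ j → i ≡ j) →
               (T (le i j) → lookup σ i ≤ lookup σ j) → T (entry i j)
      entry⁺ {i} {j} inj mono = Equivalence.from T-∧
        ( subst T (∨-comm _ (finEq i j)) (Equivalence.from (T-entry-injective i j) inj)
        , Equivalence.from T-not-∨ (≤⇒≤ᵇ ∘ mono))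

    ∈Δ⁻ : σ ∈ Δ le → IsLinearExtension le σ
    ∈Δ⁻ σ∈ with σ∈allVecs , t ← ∈-filter⁻ (T? ∘ isLinExt le) σ∈ = record
      { rank-pos  = proj₁ ∘ ∈-ranks⁻ ∘ ∈-allVecs⁻ σ∈allVecs
      ; rank-≤    = proj₂ ∘ ∈-ranks⁻ ∘ ∈-allVecs⁻ σ∈allVecs
      ; injective = λ {i} {j} → proj₁ (entry⁻ (entry-holds i j))
      ; monotone  = λ {i} {j} → proj₂ (entry⁻ (entry-holds i j))
      }
      where
      entry-holds : ∀ i j → T (entry i j)
      entry-holds i j = All.lookup (All.all⁺ (entry i) _
        (All.lookup (All.all⁺ (λ i → all (entry i) (allFin n)) _ t) (∈-allFin i))) (∈-allFin j)

    ∈Δ⁺ : IsLinearExtension le σ → σ ∈ Δ le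
    ∈Δ⁺ σ-ext = ∈-filter⁺ (T? ∘ isLinExt le)
      (∈-allVecs⁺ σ (λ i → ∈-ranks⁺ (rank-pos i) (rank-≤ i)))
      (All.all⁻ (λ i → all (entry i) (allFin n)) {allFin n}
        (All.tabulate λ {i} _ → All.all⁻ (entry i) {allFin n} (All.tabulate λ _ → entry⁺ injective monotone)))
      where open IsLinearExtension σ-ext

  private
    rankToFin : ∀ {n r} → 0 < r → r ≤ n → Fin n
    rankToFin {r = suc r} _ r<n = fromℕ< r<n

    rankToFin-injective : ∀ {n r s} (r>0 : 0 < r) (r≤n : r ≤ n) (s>0 : 0 < s) (s≤n : s ≤ n) →
                          rankToFin r>0 r≤n ≡ rankToFin s>0 s≤n → r ≡ s
    rankToFin-injective {r = suc r} {suc s} _ r≤n _ s≤n eq =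
      cong suc (trans (sym (toℕ-fromℕ< r≤n)) (trans (cong toℕ eq) (toℕ-fromℕ< s≤n)))

  injective-rank-surjective : ∀ {n} (f : Fin n → ℕ) → (∀ i → 0 < f i) → (∀ i → f i ≤ n) →
                              Injective _≡_ _≡_ f → ∀ {r} → 0 < r → r ≤ n → ∃ λ i → f i ≡ r
  injective-rank-surjective {zero}  f f>0 f≤n f-inj r>0 r≤0 = contradiction (≤-trans r>0 r≤0) λ ()
  injective-rank-surjective {suc m} f f>0 f≤n f-inj {r} r>0 r≤n with any? (λ i → f i ≟ r)
  ... | yes hit  = hit
  ... | no  miss = contradiction (injective⇒≤ squeeze-injective) (<-irrefl refl)
    where
    avoid : ∀ i → rankToFin r>0 r≤n ≢ rankToFin (f>0 i) (f≤n i)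
    avoid i eq = miss (i , sym (rankToFin-injective r>0 r≤n (f>0 i) (f≤n i) eq))
    squeeze : Fin (suc m) → Fin m
    squeeze i = punchOut (avoid i)
    squeeze-injective : Injective _≡_ _≡_ squeeze
    squeeze-injective {i} {j} eq =
      f-inj (rankToFin-injective (f>0 i) (f≤n i) (f>0 j) (f≤n j) (punchOut-injective (avoid i) (avoid j) eq))

open LinearExtensions

module Neighbours where

  open import Data.Nat using (_+_; _∸_; _≤_; _<_; _⊓_; s≤s; z≤n; _≤ᵇ_)
  open import Data.Nat.Properties
    using ( ≤⇒≤ᵇ; _≟_; ≤-refl; ≤-trans; <-≤-trans; <⇒≤; ≤∧≢⇒<; +-comm; +-cancelˡ-≡
          ; suc-injective; m⊓n≤m; m⊓n≤n; m∸n≤m; m∸n+n≡m; m<n⇒0<n∸m; m<m+n; m≤m+n; m≤n+m; n<1+n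
          ; m+n≤o⇒m≤o∸n; m≤o∸n⇒m+n≤o; module ≤-Reasoning)
  import Data.Fin.Properties as Fin
  open import Data.Rational using (0ℚ; _/_)
  import Data.Rational as ℚ
  import Data.Rational.Properties as ℚ

  module _ {n} (σ : Vec ℕ n) (i : Fin n) where

    private
      gap : Fin n → ℕ
      gap j = lookup σ i ∸ lookup σ j

      foldr-⊓-≤-init : ∀ a js → foldr (λ j m → m ⊓ gap j) a js ≤ a
      foldr-⊓-≤-init a []       = ≤-refl
      foldr-⊓-≤-init a (j ∷ js) = ≤-trans (m⊓n≤m _ _) (foldr-⊓-≤-init a js)

      foldr-⊓-≤-member : ∀ a {j} js → j ∈ js → foldr (λ j m → m ⊓ gap j) a js ≤ gap j
      foldr-⊓-≤-member a (j ∷ js) (here refl) = m⊓n≤n _ _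
      foldr-⊓-≤-member a (_ ∷ js) (there j∈)  = ≤-trans (m⊓n≤m _ _) (foldr-⊓-≤-member a js j∈)

    dist-≤-rank : ∀ le → dist le σ i ≤ lookup σ i
    dist-≤-rank le with filterᵇ (λ j → not (finEq j i) ∧ le j i) (allFin n)
    ... | []     = ≤-refl
    ... | j ∷ js = ≤-trans (foldr-⊓-≤-init (gap j) js) (m∸n≤m (lookup σ i) (lookup σ j))

    dist-≤-gap : ∀ le {j} → j ≢ i → T (le j i) → dist le σ i ≤ lookup σ i ∸ lookup σ j
    dist-≤-gap le {j} j≢i j≤i
      with filterᵇ (λ j → not (finEq j i) ∧ le j i) (allFin n)
         | ∈-filter⁺ (T? ∘ λ j → not (finEq j i) ∧ le j i) (∈-allFin j)
                     (Equivalence.from T-∧ (T-not-finEq j≢i , j≤i))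
    ... | j  ∷ js | here refl = foldr-⊓-≤-init (gap j) js
    ... | j′ ∷ js | there j∈  = foldr-⊓-≤-member (gap j′) js j∈

  lookup-shift : ∀ {n} k d (σ : Vec ℕ n) j → lookup (shift k d σ) j ≡ shiftRank k d (lookup σ j)
  lookup-shift k d σ j = lookup-map j (shiftRank k d) σ

  moveDown : ∀ {n} → Vec ℕ n → Fin n → ℕ → Vec ℕ n
  moveDown σ i d = shift (lookup σ i ∸ d) d σ

  -- Moves are parametrised by e = d − 1, matching the weight (+ 1) / suc e of gammaEntry.
  module MoveDown {n} {le : Fin n → Fin n → Bool} {σ : Vec ℕ n} (σ-ext : IsLinearExtension le σ)
                  {i : Fin n} {e : ℕ} (d<dist : suc e < dist le σ i) where

    open IsLinearExtension σ-ext

    d : ℕ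
    d = suc e

    k : ℕ
    k = lookup σ i ∸ d

    private
      d<rank : d < lookup σ i
      d<rank = <-≤-trans d<dist (dist-≤-rank σ i le)

    k+d≡rank : k + d ≡ lookup σ i
    k+d≡rank = m∸n+n≡m (<⇒≤ d<rank)

    k>0 : 0 < k
    k>0 = m<n⇒0<n∸m d<rank

    k+d≤n : k + d ≤ n
    k+d≤n = subst (_≤ n) (sym k+d≡rank) (rank-≤ i)

    private
      k<rank : k < lookup σ i
      k<rank = subst (k <_) k+d≡rank (m<m+n k (s≤s z≤n))

      predecessor-below : ∀ {j} → j ≢ i → T (le j i) → lookup σ j < k
      predecessor-below {j} j≢i j≤i = m+n≤o⇒m≤o∸n (suc (lookup σ j)) (begin
        suc (lookup σ j) + d   ≡⟨ cong suc (+-comm (lookup σ j) d) ⟩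
        suc d + lookup σ j     ≤⟨ m≤o∸n⇒m+n≤o (suc d) (monotone j≤i) d<gap ⟩
        lookup σ i             ∎)
        where
        open ≤-Reasoning
        d<gap : d < lookup σ i ∸ lookup σ j
        d<gap = <-≤-trans d<dist (dist-≤-gap σ i le j≢i j≤i)

    moveDown-at : lookup (moveDown σ i d) i ≡ k
    moveDown-at = trans (lookup-shift k d σ i) (trans (cong (shiftRank k d) (sym k+d≡rank)) shiftRank-top)

    moveDown-isLinearExtension : IsLinearExtension le (moveDown σ i d)
    moveDown-isLinearExtension = record
      { rank-pos  = λ j → subst (0 <_) (sym (lookup-shift k d σ j)) (proj₁ (range j))
      ; rank-≤    = λ j → subst (_≤ n) (sym (lookup-shift k d σ j)) (proj₂ (range j))
      ; injective = λ {a} {b} eq → injective (shiftRank-injective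
                      (trans (sym (lookup-shift k d σ a)) (trans eq (lookup-shift k d σ b))))
      ; monotone  = λ {a} {b} a≤b →
                      subst₂ _≤_ (sym (lookup-shift k d σ a)) (sym (lookup-shift k d σ b)) (mono a≤b)
      }
      where
      range : ∀ j → 0 < shiftRank k d (lookup σ j) × shiftRank k d (lookup σ j) ≤ n
      range j = shiftRank-range k>0 k+d≤n (rank-pos j) (rank-≤ j)

      mono : ∀ {a b} → T (le a b) → shiftRank k d (lookup σ a) ≤ shiftRank k d (lookup σ b)
      mono {a} {b} a≤b with a Fin.≟ b
      ... | yes refl = ≤-refl
      ... | no a≢b with lookup σ b ≟ k + d
      ...   | no σb≢k+d = shiftRank-mono (≤∧≢⇒< (monotone a≤b) (a≢b ∘ injective)) σb≢k+d
      ...   | yes σb≡k+d with injective (trans σb≡k+d k+d≡rank)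
      ...     | refl = begin
        shiftRank k d (lookup σ a)   ≡⟨ shiftRank-below a<k ⟩
        lookup σ a                   ≤⟨ <⇒≤ a<k ⟩
        k                            ≡⟨ shiftRank-top ⟨
        shiftRank k d (k + d)        ≡⟨ cong (shiftRank k d) σb≡k+d ⟨
        shiftRank k d (lookup σ b)   ∎
        where
        open ≤-Reasoning
        a<k : lookup σ a < k
        a<k = predecessor-below a≢b a≤b

    moveDown≡shift⇒ : ∀ {k′ D} → moveDown σ i d ≡ shift k′ D σ → k′ + D ≡ lookup σ i × D ≡ d
    moveDown≡shift⇒ {k′} {D} eq = sym rank≡k′+D , +-cancelˡ-≡ k D d (begin
      k + D          ≡⟨ cong (_+ D) k′≡k ⟨
      k′ + D         ≡⟨ rank≡k′+D ⟨
      lookup σ i     ≡⟨ k+d≡rank ⟨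
      k + d          ∎)
      where
      open ≡-Reasoning
      moved : shiftRank k′ D (lookup σ i) ≡ k
      moved = trans (sym (lookup-shift k′ D σ i)) (trans (cong (λ τ → lookup τ i) (sym eq)) moveDown-at)
      top-of-shift : lookup σ i ≡ k′ + D × shiftRank k′ D (lookup σ i) ≡ k′
      top-of-shift = shiftRank-decreasing (subst (_< lookup σ i) (sym moved) k<rank)
      rank≡k′+D : lookup σ i ≡ k′ + D
      rank≡k′+D = proj₁ top-of-shift
      k′≡k : k′ ≡ k
      k′≡k = trans (sym (proj₂ top-of-shift)) moved

    -- The element of rank k in σ is pushed up to k + 1 by the move, so undoing the
    -- move with a single shift forces that shift to be the transposition of k and k + 1.
    shift-moveDown≡σ⇒ : ∀ {k′ D} → shift k′ D (moveDown σ i d) ≡ σ → D ≡ d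
    shift-moveDown≡σ⇒ {k′} {D} eq = +-cancelˡ-≡ k D d (begin
      k + D        ≡⟨ cong (_+ D) k≡k′ ⟩
      k′ + D       ≡⟨ suc-k≡k′+D ⟨
      suc k        ≡⟨ rank≡suc-k ⟨
      lookup σ i   ≡⟨ k+d≡rank ⟨
      k + d        ∎)
      where
      open ≡-Reasoning
      τ : Vec ℕ n
      τ = moveDown σ i d
      undo : ∀ j → lookup σ j ≡ shiftRank k′ D (lookup τ j)
      undo j = trans (cong (λ v → lookup v j) (sym eq)) (lookup-shift k′ D τ j)
      undo-i : lookup σ i ≡ shiftRank k′ D k
      undo-i = trans (undo i) (cong (shiftRank k′ D) moveDown-at)
      rank≡suc-k : lookup σ i ≡ suc k
      rank≡suc-k = trans undo-i (shiftRank-increasing (subst (k <_) undo-i k<rank))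
      j-at-k : ∃ λ j → lookup σ j ≡ k
      j-at-k = injective-rank-surjective (lookup σ) rank-pos rank-≤ injective k>0 (≤-trans (m≤m+n k d) k+d≤n)
      j : Fin n
      j = proj₁ j-at-k
      τj≡suc-k : lookup τ j ≡ suc k
      τj≡suc-k = trans (lookup-shift k d σ j)
        (trans (cong (shiftRank k d) (proj₂ j-at-k)) (shiftRank-inside ≤-refl (m<m+n k (s≤s z≤n))))
      back : shiftRank k′ D (suc k) ≡ k
      back = trans (cong (shiftRank k′ D) (sym τj≡suc-k)) (trans (sym (undo j)) (proj₂ j-at-k))
      top-of-shift : suc k ≡ k′ + D × shiftRank k′ D (suc k) ≡ k′
      top-of-shift = shiftRank-decreasing (subst (_< suc k) (sym back) (n<1+n k))
      suc-k≡k′+D : suc k ≡ k′ + D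
      suc-k≡k′+D = proj₁ top-of-shift
      k≡k′ : k ≡ k′
      k≡k′ = trans (sym back) (proj₂ top-of-shift)

    gammaEntry-moveDown : gammaEntry σ (moveDown σ i d) ≡ (+ 1) / d
    gammaEntry-moveDown =
      FirstHit.search-satisfies C (λ d′ → (+ 1) / suc d′) (_≡ (+ 1) / d) (ranks n) (upTo n)
        (inj₂ hit) hit⇒1/d
      where
      τ : Vec ℕ n
      τ = moveDown σ i d
      C : ℕ → ℕ → Bool
      C k′ d′ = ((k′ + suc d′) ≤ᵇ n) ∧ (isShift σ τ k′ d′ ∨ isShift τ σ k′ d′)
      hit : Any (λ k′ → Any (T ∘ C k′) (upTo n)) (ranks n)
      hit = lose (∈-ranks⁺ k>0 (≤-trans (m≤m+n k d) k+d≤n))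
                 (lose (∈-upTo⁺ (≤-trans (m≤n+m d k) k+d≤n))
                       (Equivalence.from T-∧ (≤⇒≤ᵇ k+d≤n , Equivalence.from T-∨ (inj₁ (vecEq-refl τ)))))
      hit⇒1/d : ∀ {k′ d′} → k′ ∈ ranks n → d′ ∈ upTo n → T (C k′ d′) →
                (+ 1) / suc d′ ≡ (+ 1) / d
      hit⇒1/d {k′} {d′} _ _ t
        with _ , shifted ← Equivalence.to (T-∧ {(k′ + suc d′) ≤ᵇ n}) t
        with Equivalence.to (T-∨ {isShift σ τ k′ d′}) shifted
      ... | inj₁ τ-shifts-σ =
        cong (λ x → (+ 1) / suc x) (suc-injective (proj₂ (moveDown≡shift⇒ (vecEq⇒≡ τ-shifts-σ))))
      ... | inj₂ σ-shifts-τ =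
        cong (λ x → (+ 1) / suc x) (suc-injective (shift-moveDown≡σ⇒ (sym (vecEq⇒≡ σ-shifts-τ))))

  gammaEntry-nonNeg : ∀ {n} (σ τ : Vec ℕ n) → 0ℚ ℚ.≤ gammaEntry σ τ
  gammaEntry-nonNeg {n} σ τ =
    FirstHit.search-satisfies _ (λ d′ → (+ 1) / suc d′) (0ℚ ℚ.≤_) (ranks n) (upTo n) (inj₁ ℚ.≤-refl)
      (λ {_} {d′} _ _ _ → ℚ.nonNegative⁻¹ _ {{ℚ.normalize-nonNeg 1 (suc d′)}})

open Neighbours

module RowSums where

  open import Data.Nat using (_∸_; _<_; s≤s)
  open import Data.Nat.Properties using (suc-injective)
  open import Data.Rational using (_+_; _/_; _≤_)
  import Data.Rational.Properties as ℚ

  H≡∑ : ∀ q → H q ≡ ∑[ e ∈ downFrom q ] ((+ 1) / suc e)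
  H≡∑ zero    = refl
  H≡∑ (suc q) = trans (ℚ.+-comm (H q) ((+ 1) / suc q)) (cong (_+_ ((+ 1) / suc q)) (H≡∑ q))

  module _ {n} {le : Fin n → Fin n → Bool} {σ : Vec ℕ n} (σ-ext : IsLinearExtension le σ) where

    open IsLinearExtension σ-ext

    gaps : Fin n → List ℕ
    gaps i = downFrom (dist le σ i ∸ 1)

    gap-valid : ∀ {i e} → e ∈ gaps i → suc e < dist le σ i
    gap-valid {i} e∈ = m<n∸1⇒1+m<n (dist le σ i) (∈-downFrom⁻ e∈)
      where
      m<n∸1⇒1+m<n : ∀ {m} n → m < n ∸ 1 → suc m < n
      m<n∸1⇒1+m<n (suc n) m<n = s≤s m<n

    neighbourIndices : List (Fin n × ℕ)
    neighbourIndices = concatMap (λ i → map (i ,_) (gaps i)) (allFin n)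

    neighbour : Fin n × ℕ → Vec ℕ n
    neighbour (i , e) = moveDown σ i (suc e)

    ∈-neighbourIndices⁻ : ∀ {i e} → (i , e) ∈ neighbourIndices → e ∈ gaps i
    ∈-neighbourIndices⁻ p∈
      with _ , _ , p∈map ← find (∈-concatMap⁻ (λ i → map (i ,_) (gaps i)) {xs = allFin n} p∈)
      with _ , e∈ , refl ← ∈-map⁻ _ p∈map
      = e∈

    neighbourIndices-unique : Unique neighbourIndices
    neighbourIndices-unique = Unique.concat⁺
      (All.map⁺ (All.universal (λ i → Unique.map⁺ (cong proj₂) (Unique.downFrom⁺ _)) (allFin n)))
      (AllPairs.map⁺ (AllPairs.map disjoint (Unique.allFin⁺ n)))
      where
      disjoint : ∀ {i j} → i ≢ j → Disjoint (map (i ,_) (gaps i)) (map (j ,_) (gaps j))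
      disjoint i≢j (p∈i , p∈j)
        with _ , _ , refl ← ∈-map⁻ _ p∈i
        with _ , _ , eq   ← ∈-map⁻ _ p∈j
        = i≢j (cong proj₁ eq)

    neighbour-injective : ∀ {p p′} → p ∈ neighbourIndices → p′ ∈ neighbourIndices →
                          neighbour p ≡ neighbour p′ → p ≡ p′
    neighbour-injective {i , e} {i′ , e′} p∈ p′∈ eq =
      cong₂ _,_ (injective (sym rank′≡rank)) (sym (suc-injective (proj₂ (moveDown≡shift⇒ eq))))
      where
      open MoveDown σ-ext (gap-valid (∈-neighbourIndices⁻ p∈)) using (moveDown≡shift⇒)
      open MoveDown σ-ext (gap-valid (∈-neighbourIndices⁻ p′∈))
        using () renaming (k+d≡rank to k′+d′≡rank′)
      rank′≡rank : lookup σ i′ ≡ lookup σ i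
      rank′≡rank = trans (sym k′+d′≡rank′) (proj₁ (moveDown≡shift⇒ eq))

    neighbour∈Δ : ∀ {p} → p ∈ neighbourIndices → neighbour p ∈ Δ le
    neighbour∈Δ {i , e} p∈ =
      ∈Δ⁺ (MoveDown.moveDown-isLinearExtension σ-ext (gap-valid (∈-neighbourIndices⁻ p∈)))

    harmSum≤rowSum : harmSum le σ ≤ ∑ (gammaEntry σ) (Δ le)
    harmSum≤rowSum = begin
      harmSum le σ
        ≡⟨ ∑-cong (allFin n) (λ {i} _ → H≡∑ (dist le σ i ∸ 1)) ⟩
      ∑[ i ∈ allFin n ] ∑[ e ∈ gaps i ] ((+ 1) / suc e)
        ≡⟨ ∑-cong (allFin n) (λ {i} _ → ∑-cong (gaps i) (λ e∈ →
             sym (MoveDown.gammaEntry-moveDown σ-ext (gap-valid e∈)))) ⟩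
      ∑[ i ∈ allFin n ] ∑[ e ∈ gaps i ] gammaEntry σ (neighbour (i , e))
        ≡⟨ ∑-cong (allFin n) (λ {i} _ → ∑-map (gammaEntry σ ∘ neighbour) (i ,_) (gaps i)) ⟨
      ∑[ i ∈ allFin n ] ∑ (gammaEntry σ ∘ neighbour) (map (i ,_) (gaps i))
        ≡⟨ ∑-concatMap (gammaEntry σ ∘ neighbour) (λ i → map (i ,_) (gaps i)) (allFin n) ⟨
      ∑ (gammaEntry σ ∘ neighbour) neighbourIndices
        ≤⟨ ∑-≤-injective neighbourIndices-unique neighbour-injective neighbour∈Δ
             (λ _ → gammaEntry-nonNeg σ _) ⟩
      ∑ (gammaEntry σ) (Δ le) ∎
      where open ℚ.≤-Reasoning

open RowSums

module SpectralNorm where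

  import Data.Nat.Properties as ℕ
  open import Data.Nat.Coprimality as Coprime using (1-coprimeTo)
  open import Data.Rational
    using (ℚ; 0ℚ; 1ℚ; _+_; _*_; _-_; -_; _/_; _≤_; _<_; mkℚ; positive; nonNegative; nonPositive)
  open import Data.Rational.Properties
  open import Data.Rational.Solver using (module +-*-Solver)

  private
    variable
      A : Set

  square-nonNeg : ∀ t → 0ℚ ≤ t * t
  square-nonNeg t with ≤-total 0ℚ t
  ... | inj₁ t≥0 = nonNegative⁻¹ _ {{nonNeg*nonNeg⇒nonNeg t {{nonNegative t≥0}} t {{nonNegative t≥0}}}}
  ... | inj₂ t≤0 = nonNegative⁻¹ _ {{nonPos*nonPos⇒nonPos t {{nonPositive t≤0}} t {{nonPositive t≤0}}}}

  2ab≤b²+a² : ∀ a b → a * b + a * b ≤ b * b + a * a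
  2ab≤b²+a² a b = begin
    a * b + a * b                        ≡⟨ +-identityˡ _ ⟨
    0ℚ + (a * b + a * b)                 ≤⟨ +-monoˡ-≤ (a * b + a * b) (square-nonNeg (b - a)) ⟩
    (b - a) * (b - a) + (a * b + a * b)  ≡⟨ solve 2 (λ a b → (b :- a) :* (b :- a) :+ (a :* b :+ a :* b)
                                                            := b :* b :+ a :* a) refl a b ⟩
    b * b + a * a                        ∎
    where
    open ≤-Reasoning
    open +-*-Solver

  +-cancelʳ-≤ : ∀ a b c → a + c ≤ b + c → a ≤ b
  +-cancelʳ-≤ a b c a+c≤b+c = begin
    a           ≡⟨ solve 2 (λ a c → a := a :+ c :- c) refl a c ⟩
    a + c - c   ≤⟨ +-monoˡ-≤ (- c) a+c≤b+c ⟩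
    b + c - c   ≡⟨ solve 2 (λ b c → b :+ c :- c := b) refl b c ⟩
    b           ∎
    where
    open ≤-Reasoning
    open +-*-Solver

  ∑-ones : (xs : List A) → ∑ (λ _ → 1ℚ) xs ≡ (+ length xs) / 1
  ∑-ones []       = refl
  ∑-ones (x ∷ xs) = trans (cong (_+_ 1ℚ) (∑-ones xs)) (1+[m]≡[1+m] (length xs))
    where
    1+[m]≡[1+m] : ∀ m → 1ℚ + (+ m) / 1 ≡ (+ suc m) / 1
    1+[m]≡[1+m] zero    = refl
    1+[m]≡[1+m] (suc m) rewrite normalize-coprime {suc m} {0} (Coprime.sym (1-coprimeTo (suc m))) =
      cong (λ m′ → (+ suc m′) / 1) (ℕ.*-identityʳ (suc m))

  -- After normalisation the left factor is literally 1/ of the right one.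
  1/[1+m]*[1+m]≡1 : ∀ m → ((+ 1) / suc m) * ((+ suc m) / 1) ≡ 1ℚ
  1/[1+m]*[1+m]≡1 m = trans (cong₂ _*_ (normalize-coprime (1-coprimeTo (suc m))) (normalize-coprime c))
                            (*-inverseˡ (mkℚ (+ suc m) 0 c))
    where
    c : Coprime.Coprime (suc m) 1
    c = Coprime.sym (1-coprimeTo (suc m))

  average*count≡∑ : (h : A → ℚ) (xs : List A) → average (map h xs) * ∑ (λ _ → 1ℚ) xs ≡ ∑ h xs
  average*count≡∑ h []       = refl
  average*count≡∑ h (x ∷ xs) = begin
    S * u * ∑ (λ _ → 1ℚ) (x ∷ xs)            ≡⟨ *-assoc S u _ ⟩
    S * (u * ∑ (λ _ → 1ℚ) (x ∷ xs))          ≡⟨ cong (λ c → S * (u * c)) (∑-ones (x ∷ xs)) ⟩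
    S * (u * ((+ suc (length xs)) / 1))       ≡⟨ cong (λ m → S * (u * ((+ suc m) / 1))) (length-map h xs) ⟨
    S * (u * ((+ suc (length (map h xs))) / 1)) ≡⟨ cong (S *_) (1/[1+m]*[1+m]≡1 (length (map h xs))) ⟩
    S * 1ℚ                                    ≡⟨ *-identityʳ S ⟩
    S                                         ∎
    where
    open ≡-Reasoning
    S u : ℚ
    S = ∑ h (x ∷ xs)
    u = (+ 1) / suc (length (map h xs))

  -- Sum 2Eh ≤ 2ER ≤ R² + E² over L, where E is the mean of h.
  mean²*count≤∑R² : (L : List A) (h R : A → ℚ) → (∀ {x} → x ∈ L → h x ≤ R x) →
                    0ℚ ≤ average (map h L) →
                    average (map h L) * average (map h L) * ∑ (λ _ → 1ℚ) L ≤ ∑[ x ∈ L ] (R x * R x)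
  mean²*count≤∑R² L h R h≤R E≥0 = +-cancelʳ-≤ (E * E * M) _ (E * E * M) (begin
    E * E * M + E * E * M                        ≡⟨ cong₂ _+_ E²M≡E∑h E²M≡E∑h ⟩
    E * ∑ h L + E * ∑ h L                        ≡⟨ cong₂ _+_ (∑-*ˡ E h L) (∑-*ˡ E h L) ⟨
    ∑[ x ∈ L ] (E * h x) + ∑[ x ∈ L ] (E * h x)  ≡⟨ ∑-+ (λ x → E * h x) (λ x → E * h x) L ⟨
    ∑[ x ∈ L ] (E * h x + E * h x)               ≤⟨ ∑-mono-≤ L pointwise ⟩
    ∑[ x ∈ L ] (R x * R x + E * E)               ≡⟨ ∑-+ (λ x → R x * R x) (λ _ → E * E) L ⟩
    ∑[ x ∈ L ] (R x * R x) + ∑[ x ∈ L ] (E * E)  ≡⟨ cong (_+_ (∑[ x ∈ L ] (R x * R x))) ∑E²≡E²M ⟩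
    ∑[ x ∈ L ] (R x * R x) + E * E * M           ∎)
    where
    open ≤-Reasoning
    E M : ℚ
    E = average (map h L)
    M = ∑ (λ _ → 1ℚ) L

    E²M≡E∑h : E * E * M ≡ E * ∑ h L
    E²M≡E∑h = trans (*-assoc E E M) (cong (E *_) (average*count≡∑ h L))

    ∑E²≡E²M : ∑[ x ∈ L ] (E * E) ≡ E * E * M
    ∑E²≡E²M = trans (∑-cong L (λ _ → sym (*-identityʳ (E * E)))) (∑-*ˡ (E * E) (λ _ → 1ℚ) L)

    pointwise : ∀ {x} → x ∈ L → E * h x + E * h x ≤ R x * R x + E * E
    pointwise {x} x∈ = ≤-trans (+-mono-≤ Eh≤ER Eh≤ER) (2ab≤b²+a² E (R x))
      where
      Eh≤ER : E * h x ≤ E * R x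
      Eh≤ER = *-monoˡ-≤-nonNeg E {{nonNegative E≥0}} (h≤R x∈)

  q²*count<∑R² : (L : List A) (h R : A → ℚ) → (∀ {x} → x ∈ L → h x ≤ R x) →
                 ∀ {q} → 0ℚ ≤ q → q < average (map h L) →
                 q * q * ∑ (λ _ → 1ℚ) L < ∑[ x ∈ L ] (R x * R x)
  q²*count<∑R² []         h R _   0≤q q<0 = contradiction (≤-<-trans 0≤q q<0) (<-irrefl refl)
  q²*count<∑R² L@(_ ∷ xs) h R h≤R {q} 0≤q q<E = begin-strict
    q * q * M               <⟨ *-monoˡ-<-pos M {{positive M>0}} q²<E² ⟩
    E * E * M               ≤⟨ mean²*count≤∑R² L h R h≤R (<⇒≤ E>0) ⟩
    ∑[ x ∈ L ] (R x * R x)  ∎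
    where
    open ≤-Reasoning
    E M : ℚ
    E = average (map h L)
    M = ∑ (λ _ → 1ℚ) L

    E>0 : 0ℚ < E
    E>0 = ≤-<-trans 0≤q q<E

    M>0 : 0ℚ < M
    M>0 = <-≤-trans (positive⁻¹ 1ℚ) (≤-trans (≤-reflexive (sym (+-identityʳ 1ℚ)))
            (+-monoʳ-≤ 1ℚ (∑-nonNeg xs (λ _ → nonNegative⁻¹ 1ℚ))))

    q²<E² : q * q < E * E
    q²<E² = ≤-<-trans (*-monoˡ-≤-nonNeg q {{nonNegative 0≤q}} (<⇒≤ q<E))
                      (*-monoˡ-<-pos E {{positive E>0}} q<E)

  sumF-lookup : (L : List A) (f : A → ℚ) → sumF (f ∘ llookup L) ≡ ∑ f L
  sumF-lookup L f = cong sumℚ (begin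
    map (f ∘ llookup L) (allFin (length L))   ≡⟨ map-tabulate id (f ∘ llookup L) ⟩
    tabulate (f ∘ llookup L)                  ≡⟨ map-tabulate (llookup L) f ⟨
    map f (tabulate (llookup L))              ≡⟨ cong (map f) (tabulate-lookup L) ⟩
    map f L                                   ∎)
    where open ≡-Reasoning

  specNormAtLeast-average : (L : List A) (γ : A → A → ℚ) (h : A → ℚ) →
                            (∀ {x} → x ∈ L → h x ≤ ∑ (γ x) L) →
                            SpecNormAtLeast (λ a b → γ (llookup L a) (llookup L b)) (average (map h L))
  specNormAtLeast-average {A} L γ h h≤rowSum q 0≤q q<E =
    𝟏 , subst₂ (λ a b → q * q * a < b) (sym ‖𝟏‖²) (sym ‖M𝟏‖²)
          (q²*count<∑R² L h rowSum h≤rowSum 0≤q q<E)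
    where
    M : Fin (length L) → Fin (length L) → ℚ
    M a b = γ (llookup L a) (llookup L b)
    𝟏 : Fin (length L) → ℚ
    𝟏 _ = 1ℚ
    rowSum : A → ℚ
    rowSum x = ∑ (γ x) L
    ‖𝟏‖² : normSq 𝟏 ≡ ∑ (λ _ → 1ℚ) L
    ‖𝟏‖² = sumF-lookup L (λ _ → 1ℚ)
    M𝟏 : ∀ a → mulVec M 𝟏 a ≡ rowSum (llookup L a)
    M𝟏 a = trans (cong sumℚ (map-cong (λ b → *-identityʳ (M a b)) (allFin (length L))))
                 (sumF-lookup L (γ (llookup L a)))
    ‖M𝟏‖² : normSq (mulVec M 𝟏) ≡ ∑[ x ∈ L ] (rowSum x * rowSum x)
    ‖M𝟏‖² = trans (cong sumℚ (map-cong (λ a → cong₂ _*_ (M𝟏 a) (M𝟏 a)) (allFin (length L))))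
                  (sumF-lookup L (λ x → rowSum x * rowSum x))

open SpectralNorm

lemma5 : (n : ℕ) (le : Fin n → Fin n → Bool) → IsPoset le →
    SpecNormAtLeast (Γ le) (expectation le)
lemma5 n le _ = specNormAtLeast-average (Δ le) gammaEntry (harmSum le) (harmSum≤rowSum ∘ ∈Δ⁻)
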